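{- Let $T$ be a graph with a right $\mathbb Z_2$-action, and let $n\ge0$, $m\ge3$. If there is a $\mathbb Z_2$-equivariant graph homomorphism $T\to K_{n+2}$, where $\mathbb Z_2$ acts on $K_{n+2}$ by exchanging the vertices $1$ and $2$ and fixing all others, then there is a $\mathbb Z_2$-equivariant graph homomorphism $T\times_{\mathbb Z_2}\mathcal C^1_{2m}\to K_{n+3}$, with $\mathbb Z_2$ acting on $K_{n+3}$ by exchanging $1$ and $2$ and fixing all others.
   Context: Graphs are finite, undirected, loops allowed; $K_N$ is the loopless complete graph on $\{1,\dots,N\}$. $\mathcal C^1_{2m}$ is the reflexive $2m$-cycle: vertices $\mathbb Z/2m$, with $i\sim j$ iff $j-i\in\{ -1,0,1\}$. It carries a left $\mathbb Z_2$-action (antipodal) $i\mapsto i+m$ and a commuting right $\mathbb Z_2$-action (reflection) $i\mapsto 2m-1-i$. $T\times_{\mathbb Z_2}\mathcal C^1_{2m}$ is the graph on the classes of $V(T)\times\mathbb Z/2m$ under $(t\tau,i)\sim(t,i+m)$ ($\tau$ the nontrivial element), with $[(t,i)]\sim[(t',i')]$ iff some representatives satisfy $t\sim t'$ and $i\sim i'$; its $\mathbb Z_2$-action is $[(t,i)]\mapsto[(t,2m-1-i)]$. -}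

module Defs where

open import Data.Nat using (ℕ; zero; suc; _+_; _*_)
open import Data.Nat.DivMod using (_mod_)
open import Data.Fin using (Fin; zero; suc; toℕ; opposite)
open import Data.Product using (_×_; _,_; Σ; ∃)
open import Data.Sum using (_⊎_)
open import Relation.Binary.PropositionalEquality using (_≡_; _≢_)

record Z2Graph : Set₁ where
  field
    nV      : ℕ
    _~_     : Fin nV → Fin nV → Set
    ~-sym   : ∀ {x y} → x ~ y → y ~ x
    τ       : Fin nV → Fin nV
    τ-invol : ∀ x → τ (τ x) ≡ x
    τ-hom   : ∀ {x y} → x ~ y → τ x ~ τ y

-- The involution of K_{N+2} exchanging vertices 1 and 2 (= Fin indices 0 and 1)
-- and fixing all others.
swap12 : ∀ {N} → Fin (suc (suc N)) → Fin (suc (suc N))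
swap12 zero          = suc zero
swap12 (suc zero)    = zero
swap12 (suc (suc x)) = suc (suc x)

-- Z2-equivariant graph homomorphism T → K_{N+2}  (K loopless: adjacency = ≢).
EquivHomToK : (T : Z2Graph) (N : ℕ) → Set
EquivHomToK T N =
  Σ (Fin nV → Fin (suc (suc N))) λ f →
    (∀ {x y} → x ~ y → f x ≢ f y) × (∀ x → f (τ x) ≡ swap12 (f x))
  where open Z2Graph T

plusMod : (N : ℕ) → Fin N → ℕ → Fin N
plusMod (suc k) i a = (toℕ i + a) mod (suc k)

-- Adjacency in the reflexive cycle C^1_N (vertices Z/N): j - i ∈ {-1,0,1}.
cycAdj : (N : ℕ) → Fin N → Fin N → Set
cycAdj N i j = (j ≡ i) ⊎ (j ≡ plusMod N i 1) ⊎ (i ≡ plusMod N j 1)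

PV : (T : Z2Graph) (m : ℕ) → Set
PV T m = Fin (Z2Graph.nV T) × Fin (2 * m)

prodAdj : (T : Z2Graph) (m : ℕ) → PV T m → PV T m → Set
prodAdj T m (t , i) (t' , i') = (t ~ t') × cycAdj (2 * m) i i'
  where open Z2Graph T

-- The equivalence relation defining T ×_{Z2} C^1_{2m}: it is generated by
-- (tτ, i) ≈ (t, i+m); since τ is an involution and 2m ≡ 0, the class of (t,i)
-- is exactly {(t,i), (tτ, i+m)}.
PEquiv : (T : Z2Graph) (m : ℕ) → PV T m → PV T m → Set
PEquiv T m (t , i) (t' , i') =
  ((t' ≡ t) × (i' ≡ i)) ⊎ ((t' ≡ τ t) × (i' ≡ plusMod (2 * m) i m))
  where open Z2Graph T

QAdj : (T : Z2Graph) (m : ℕ) → PV T m → PV T m → Set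
QAdj T m x y =
  ∃ λ x' → ∃ λ y' → PEquiv T m x x' × PEquiv T m y y' × prodAdj T m x' y'

-- A Z2-equivariant graph homomorphism T ×_{Z2} C^1_{2m} → K_{N+2}, presented as a
-- map on representatives that is constant on equivalence classes (i.e. a map on the
-- quotient), sends adjacent classes to distinct vertices, and intertwines the action
-- [(t,i)] ↦ [(t, 2m-1-i)] (opposite i = 2m-1-i) with swap12.
EquivHomQuotToK : (T : Z2Graph) (m N : ℕ) → Set
EquivHomQuotToK T m N =
  Σ (PV T m → Fin (suc (suc N))) λ g →
    (∀ x y → PEquiv T m x y → g x ≡ g y)
    × (∀ x y → QAdj T m x y → g x ≢ g y)
    × (∀ t i → g (t , opposite i) ≡ swap12 (g (t , i)))

-- Recolour f as follows: a vertex (t, i) with f t = 1 gets the colour of the arc of Z/2m containing i,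
-- one with f t = 2 the colour of the arc containing i + m, and every other vertex keeps the colour f t.
-- The arcs [0, m−2], {m−1, m}, [m+1, 2m−1] are coloured 1, n+3, 2. The map is well defined on classes
-- because τ swaps the colours 1 and 2, and equivariant because i ↦ 2m−1−i swaps the two outer arcs and
-- fixes the middle one. It is proper because for adjacent (t, i), (t', j) with f t = 1 and f t' = 2 the
-- points i and j + m are at cyclic distance m−1, m or m+1, whereas two points of one arc are at distance
-- at most m−2 (for the middle arc this is where m ≥ 3 is needed).
module Submission where

open import Defs
open import Data.Empty using (⊥; ⊥-elim)
open import Data.Fin using (Fin; zero; suc; toℕ; opposite; _↑ˡ_; _↑ʳ_)
open import Data.Fin.Properties using (toℕ<n; toℕ-fromℕ<; toℕ-↑ˡ; toℕ-↑ʳ; ↑ˡ-injective; suc-injective; opposite-prop; toℕ-injective)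
open import Data.Nat using (ℕ; suc; _+_; _*_; _∸_; _≤_; _<_; z≤n; s≤s; NonZero)
open import Data.Nat.DivMod using (_%_; m<n⇒m%n≡m; [m+n]%n≡m%n)
open import Data.Nat.Properties hiding (suc-injective)
open import Data.Nat.Tactic.RingSolver using (solve-∀)
open import Data.Product using (Σ; _×_; _,_; proj₁; proj₂)
open import Data.Sum using (_⊎_; inj₁; inj₂)
open import Relation.Nullary using (yes; no)
open import Function using (_∘_)
open import Relation.Binary.PropositionalEquality

0<n⇒m+n≰m : ∀ {m n} → 0 < n → m + n ≤ m → ⊥
0<n⇒m+n≰m {m} {suc n} _ le = m+n≮m m n (subst (_≤ m) (+-suc m n) le)

m+m≤n+m+m : ∀ m n → m + m ≤ n + m + m
m+m≤n+m+m m n = +-monoˡ-≤ m (m≤n+m m n)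

Near : ℕ → ℕ → Set
Near a b = a ≤ suc b × b ≤ suc a

Near-sym : ∀ {a b} → Near a b → Near b a
Near-sym (p , q) = q , p

Near-+ʳ : ∀ {a b} c → Near a b → Near (a + c) (b + c)
Near-+ʳ c (p , q) = +-monoˡ-≤ c p , +-monoˡ-≤ c q

Near-cancelʳ : ∀ {a b} c → Near (a + c) (b + c) → Near a b
Near-cancelʳ {a} {b} c (p , q) = +-cancelʳ-≤ c a (suc b) p , +-cancelʳ-≤ c b (suc a) q

Near-+1 : ∀ k → Near k (k + 1)
Near-+1 k rewrite +-comm k 1 = ≤-trans (n≤1+n k) (n≤1+n (suc k)) , ≤-refl

ReducedOnce : ℕ → ℕ → ℕ → Set
ReducedOnce N x y = y ≡ x ⊎ y + N ≡ x

%-reducedOnce : ∀ {N x} .{{_ : NonZero N}} → x < N + N → ReducedOnce N x (x % N)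
%-reducedOnce {N} {x} x<2N with x <? N
... | yes x<N = inj₁ (m<n⇒m%n≡m x<N)
... | no x≮N = inj₂ (trans (cong (_+ N) x%N≡y) y+N≡x)
  where
  y = x ∸ N
  y+N≡x : y + N ≡ x
  y+N≡x = m∸n+n≡m (≮⇒≥ x≮N)
  x%N≡y : x % N ≡ y
  x%N≡y = begin
    x % N       ≡⟨ cong (_% N) (sym y+N≡x) ⟩
    (y + N) % N ≡⟨ [m+n]%n≡m%n y N ⟩
    y % N       ≡⟨ m<n⇒m%n≡m (+-cancelʳ-< N y N (subst (_< N + N) (sym y+N≡x) x<2N)) ⟩
    y           ∎
    where open ≡-Reasoning

plusMod-reducedOnce : ∀ {N a} (i : Fin N) → a ≤ N → ReducedOnce N (toℕ i + a) (toℕ (plusMod N i a))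
plusMod-reducedOnce {suc _} {a} i a≤N =
  subst (λ y → ReducedOnce _ (toℕ i + a) y) (sym (toℕ-fromℕ< _)) (%-reducedOnce (+-mono-<-≤ (toℕ<n i) a≤N))

NearMod : ℕ → ℕ → ℕ → Set
NearMod N k l = Near k l ⊎ Near (k + N) l ⊎ Near k (l + N)

NearMod-sym : ∀ {N k l} → NearMod N k l → NearMod N l k
NearMod-sym (inj₁ p)        = inj₁ (Near-sym p)
NearMod-sym (inj₂ (inj₁ p)) = inj₂ (inj₂ (Near-sym p))
NearMod-sym (inj₂ (inj₂ p)) = inj₂ (inj₁ (Near-sym p))

reducedOnce-+1⇒NearMod : ∀ {N k l} → ReducedOnce N (k + 1) l → NearMod N k l
reducedOnce-+1⇒NearMod {k = k} (inj₁ refl) = inj₁ (Near-+1 k)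
reducedOnce-+1⇒NearMod {k = k} (inj₂ e)    = inj₂ (inj₂ (subst (Near k) (sym e) (Near-+1 k)))

Antipodal : ℕ → ℕ → ℕ → Set
Antipodal m a b = a ≡ b + m ⊎ b ≡ a + m

Antipodal-sym : ∀ {m a b} → Antipodal m a b → Antipodal m b a
Antipodal-sym (inj₁ e) = inj₂ e
Antipodal-sym (inj₂ e) = inj₁ e

reducedOnce⇒Antipodal : ∀ {m a b} → ReducedOnce (m + m) (a + m) b → Antipodal m a b
reducedOnce⇒Antipodal         (inj₁ e) = inj₂ e
reducedOnce⇒Antipodal {m} {a} {b} (inj₂ e) = inj₁ (sym (+-cancelʳ-≡ m (b + m) a (trans (+-assoc b m m) e)))

Antipodal-functional : ∀ {m a b c} → b < m + m → c < m + m →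
  Antipodal m a b → Antipodal m a c → b ≡ c
Antipodal-functional {m} {b = b} {c} _ _ (inj₁ e) (inj₁ e') = +-cancelʳ-≡ m b c (trans (sym e) e')
Antipodal-functional _ _ (inj₂ refl) (inj₂ refl) = refl
Antipodal-functional {m} {b = b} _ c<2m (inj₁ refl) (inj₂ refl) = ⊥-elim (<⇒≱ c<2m (m+m≤n+m+m m b))
Antipodal-functional {m} {c = c} b<2m _ (inj₂ refl) (inj₁ refl) = ⊥-elim (<⇒≱ b<2m (m+m≤n+m+m m c))

NearAntipodal : ℕ → ℕ → ℕ → Set
NearAntipodal m k s = Near (k + m) s ⊎ Near k (s + m)

NearMod-Antipodal⇒NearAntipodal : ∀ {m k l s} → 0 < m → k < m + m → s < m + m →
  NearMod (m + m) k l → Antipodal m l s → NearAntipodal m k s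
NearMod-Antipodal⇒NearAntipodal _ _ _ (inj₁ p) (inj₁ refl) = inj₂ p
NearMod-Antipodal⇒NearAntipodal {m} _ _ _ (inj₁ p) (inj₂ refl) = inj₁ (Near-+ʳ m p)
NearMod-Antipodal⇒NearAntipodal {m} {k} {s = s} _ _ _ (inj₂ (inj₁ p)) (inj₁ refl) =
  inj₁ (Near-cancelʳ m (subst (λ x → Near x (s + m)) (sym (+-assoc k m m)) p))
NearMod-Antipodal⇒NearAntipodal {m} {k} _ _ _ (inj₂ (inj₂ p)) (inj₂ refl) =
  inj₂ (subst (Near k) (sym (+-assoc _ m m)) p)
NearMod-Antipodal⇒NearAntipodal {m} {k} m>0 _ s<2m (inj₂ (inj₁ (p , _))) (inj₂ refl) =
  ⊥-elim (0<n⇒m+n≰m m>0 (≤-trans (+-monoˡ-≤ m (m≤n+m (m + m) k)) (≤-trans (+-monoˡ-≤ m p) s<2m)))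
NearMod-Antipodal⇒NearAntipodal {m} {s = s} m>0 k<2m _ (inj₂ (inj₂ (_ , q))) (inj₁ refl) =
  ⊥-elim (0<n⇒m+n≰m (≤-trans m>0 (m≤n+m m s)) (≤-trans (≤-reflexive (+-comm (m + m) (s + m))) (≤-trans q k<2m)))

data Zone : Set where
  low middle high : Zone

flip : Zone → Zone
flip low    = high
flip middle = middle
flip high   = low

InZone : Zone → ℕ → ℕ → Set
InZone low    m k = suc (suc k) ≤ m
InZone middle m k = m ≤ suc k × k ≤ m
InZone high   m k = m < k

classify : ∀ m k → Σ Zone λ z → InZone z m k
classify m k with suc (suc k) ≤? m | m <? k
... | yes k+2≤m | _       = low , k+2≤m
... | no _      | yes m<k = high , m<k
... | no k+2≰m  | no m≮k  = middle , (≤-pred (≰⇒> k+2≰m) , ≮⇒≥ m≮k)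

zone : ℕ → ℕ → Zone
zone m k = proj₁ (classify m k)

zone-spec : ∀ m k → InZone (zone m k) m k
zone-spec m k = proj₂ (classify m k)

InZone-unique : ∀ {z z' m k} → InZone z m k → InZone z' m k → z ≡ z'
InZone-unique {low}    {low}    _ _ = refl
InZone-unique {middle} {middle} _ _ = refl
InZone-unique {high}   {high}   _ _ = refl
InZone-unique {low}    {middle} p (q , _) = ⊥-elim (<⇒≱ p q)
InZone-unique {low}    {high}   p q = ⊥-elim (<⇒≱ p (≤-trans (<⇒≤ q) (n≤1+n _)))
InZone-unique {middle} {high}   (_ , p) q = ⊥-elim (<⇒≱ q p)
InZone-unique {middle} {low}    p q = sym (InZone-unique q p)
InZone-unique {high}   {low}    p q = sym (InZone-unique q p)
InZone-unique {high}   {middle} p q = sym (InZone-unique q p)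

Mirror : ℕ → ℕ → ℕ → Set
Mirror N a b = b + suc a ≡ N

InZone-mirror : ∀ {z m k r} → Mirror (m + m) k r → InZone z m k → InZone (flip z) m r
InZone-mirror {low} {m} {k} {r} e k+2≤m = +-cancelʳ-≤ (suc k) (suc m) r (begin
  suc m + suc k   ≡⟨ +-suc m (suc k) ⟨
  m + suc (suc k) ≤⟨ +-monoʳ-≤ m k+2≤m ⟩
  m + m           ≡⟨ e ⟨
  r + suc k       ∎)
  where open ≤-Reasoning
InZone-mirror {middle} {m} {k} {r} e (m≤k+1 , k≤m) = +-cancelʳ-≤ m m (suc r) m+m≤r+1+m , +-cancelʳ-≤ m r m r+m≤m+m
  where
  open ≤-Reasoning
  m+m≤r+1+m : m + m ≤ suc r + m
  m+m≤r+1+m = begin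
    m + m     ≡⟨ e ⟨
    r + suc k ≤⟨ +-monoʳ-≤ r (s≤s k≤m) ⟩
    r + suc m ≡⟨ +-suc r m ⟩
    suc r + m ∎
  r+m≤m+m : r + m ≤ m + m
  r+m≤m+m = begin
    r + m     ≤⟨ +-monoʳ-≤ r m≤k+1 ⟩
    r + suc k ≡⟨ e ⟩
    m + m     ∎
InZone-mirror {high} {m} {k} {r} e m<k = +-cancelʳ-≤ m (suc (suc r)) m (begin
  suc (suc r) + m ≡⟨ suc-suc-+ r m ⟩
  r + suc (suc m) ≤⟨ +-monoʳ-≤ r (s≤s m<k) ⟩
  r + suc k       ≡⟨ e ⟩
  m + m           ∎)
  where
  open ≤-Reasoning
  suc-suc-+ : ∀ a b → suc (suc a) + b ≡ a + suc (suc b)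
  suc-suc-+ = solve-∀

zone-mirror : ∀ {m k r} → Mirror (m + m) k r → zone m r ≡ flip (zone m k)
zone-mirror {m} {k} {r} e = InZone-unique (zone-spec m r) (InZone-mirror e (zone-spec m k))

InZone-antipodal-separated : ∀ {z m k s} → 3 ≤ m → s < m + m →
  InZone z m k → InZone z m s → Near (k + m) s → ⊥
InZone-antipodal-separated {low} {m} {k} _ _ _ s+2≤m (k+m≤s+1 , _) =
  <⇒≱ s+2≤m (≤-trans (m≤n+m m k) k+m≤s+1)
InZone-antipodal-separated {middle} {m} {k} {s} 3≤m _ (m≤k+1 , _) (_ , s≤m) (k+m≤s+1 , _) =
  <⇒≱ 3≤m (+-cancelʳ-≤ m m 2 (begin
    m + m           ≤⟨ +-monoˡ-≤ m m≤k+1 ⟩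
    suc (k + m)     ≤⟨ s≤s k+m≤s+1 ⟩
    suc (suc s)     ≤⟨ s≤s (s≤s s≤m) ⟩
    2 + m           ∎))
  where open ≤-Reasoning
InZone-antipodal-separated {high} {m} _ s<2m m<k _ (k+m≤s+1 , _) =
  <⇒≱ s<2m (≤-pred (≤-trans (+-monoˡ-≤ m m<k) k+m≤s+1))

NearAntipodal-separated : ∀ {z m k s} → 3 ≤ m → k < m + m → s < m + m →
  InZone z m k → InZone z m s → NearAntipodal m k s → ⊥
NearAntipodal-separated 3≤m _ s<2m zk zs (inj₁ p) = InZone-antipodal-separated 3≤m s<2m zk zs p
NearAntipodal-separated 3≤m k<2m _ zk zs (inj₂ p) = InZone-antipodal-separated 3≤m k<2m zs zk (Near-sym p)

Antipodal-mirror : ∀ {m k r a b} → a < m + m → b < m + m →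
  Antipodal m k a → Antipodal m r b → Mirror (m + m) k r → Mirror (m + m) a b
Antipodal-mirror {m} {k} {r} a<2m b<2m (inj₂ refl) (inj₂ refl) e =
  ⊥-elim (<⇒≢ (+-mono-≤ (+-cancelʳ-< m r m b<2m) (+-cancelʳ-< m k m a<2m)) e)
Antipodal-mirror {m} {k} {b = b} _ _ (inj₂ refl) (inj₁ refl) e = trans (rearrange b k m) e
  where
  rearrange : ∀ x y z → x + suc (y + z) ≡ x + z + suc y
  rearrange = solve-∀
Antipodal-mirror {m} {r = r} {a} _ _ (inj₁ refl) (inj₂ refl) e = trans (rearrange r a m) e
  where
  rearrange : ∀ x y z → x + z + suc y ≡ x + suc (y + z)
  rearrange = solve-∀
Antipodal-mirror {m} {a = a} {b} _ _ (inj₁ refl) (inj₁ refl) e =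
  ⊥-elim (m<n⇒n≢0 (m≤n+m (suc a) b) (+-cancelʳ-≡ (m + m) (b + suc a) 0 (trans (rearrange b a m) e)))
  where
  rearrange : ∀ x y z → x + suc y + (z + z) ≡ x + z + suc (y + z)
  rearrange = solve-∀

cycAdj-sym : ∀ {N i j} → cycAdj N i j → cycAdj N j i
cycAdj-sym (inj₁ e)        = inj₁ (sym e)
cycAdj-sym (inj₂ (inj₁ e)) = inj₂ (inj₂ e)
cycAdj-sym (inj₂ (inj₂ e)) = inj₂ (inj₁ e)

paint : ∀ {n} → Zone → Fin (suc (suc (n + 1)))
paint         low    = zero
paint {n}     middle = suc (suc (n ↑ʳ zero))
paint         high   = suc zero

old : ∀ {n} → Fin n → Fin (suc (suc (n + 1)))
old c = suc (suc (c ↑ˡ 1))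

old-injective : ∀ {n} {c c' : Fin n} → old c ≡ old c' → c ≡ c'
old-injective {c = c} {c'} e = ↑ˡ-injective 1 c c' (suc-injective (suc-injective e))

paint-injective : ∀ {n z z'} → paint {n} z ≡ paint z' → z ≡ z'
paint-injective {z = low}    {low}    _ = refl
paint-injective {z = middle} {middle} _ = refl
paint-injective {z = high}   {high}   _ = refl

paint-flip : ∀ {n} z → paint {n} (flip z) ≡ swap12 (paint z)
paint-flip low    = refl
paint-flip middle = refl
paint-flip high   = refl

paint≢old : ∀ {n} z (c : Fin n) → paint z ≢ old c
paint≢old low    c ()
paint≢old high   c ()
paint≢old {n} middle c e = <⇒≢ (toℕ<n c) (begin
  toℕ c          ≡⟨ toℕ-↑ˡ c 1 ⟨
  toℕ (c ↑ˡ 1)   ≡⟨ cong toℕ (suc-injective (suc-injective e)) ⟨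
  toℕ (n ↑ʳ zero) ≡⟨ toℕ-↑ʳ n zero ⟩
  n + 0          ≡⟨ +-identityʳ n ⟩
  n              ∎)
  where open ≡-Reasoning

module Cycle (m : ℕ) (3≤m : 3 ≤ m) where

  2m≡m+m : 2 * m ≡ m + m
  2m≡m+m = cong (m +_) (+-identityʳ m)

  toℕ<m+m : (i : Fin (2 * m)) → toℕ i < m + m
  toℕ<m+m i = subst (toℕ i <_) 2m≡m+m (toℕ<n i)

  plusMod-reducedOnce′ : ∀ {a} (i : Fin (2 * m)) → a ≤ 2 * m →
    ReducedOnce (m + m) (toℕ i + a) (toℕ (plusMod (2 * m) i a))
  plusMod-reducedOnce′ {a} i a≤2m =
    subst (λ N → ReducedOnce N (toℕ i + a) (toℕ (plusMod (2 * m) i a))) 2m≡m+m (plusMod-reducedOnce i a≤2m)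

  successor-NearMod : (i : Fin (2 * m)) → NearMod (m + m) (toℕ i) (toℕ (plusMod (2 * m) i 1))
  successor-NearMod i = reducedOnce-+1⇒NearMod (plusMod-reducedOnce′ i (≤-trans (s≤s z≤n) (toℕ<n i)))

  cycAdj⇒NearMod : ∀ {i j} → cycAdj (2 * m) i j → NearMod (m + m) (toℕ i) (toℕ j)
  cycAdj⇒NearMod {i} (inj₁ refl)        = inj₁ (n≤1+n (toℕ i) , n≤1+n (toℕ i))
  cycAdj⇒NearMod {i} (inj₂ (inj₁ refl)) = successor-NearMod i
  cycAdj⇒NearMod {j = j} (inj₂ (inj₂ refl)) = NearMod-sym (successor-NearMod j)

  antipode : Fin (2 * m) → Fin (2 * m)
  antipode i = plusMod (2 * m) i m

  antipode-antipodal : ∀ i → Antipodal m (toℕ i) (toℕ (antipode i))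
  antipode-antipodal i = reducedOnce⇒Antipodal (plusMod-reducedOnce′ i (m≤m+n m (m + 0)))

  antipode-involutive : ∀ i → antipode (antipode i) ≡ i
  antipode-involutive i = toℕ-injective (Antipodal-functional (toℕ<m+m _) (toℕ<m+m i)
    (antipode-antipodal (antipode i)) (Antipodal-sym (antipode-antipodal i)))

  opposite-mirror : ∀ i → Mirror (m + m) (toℕ i) (toℕ (opposite i))
  opposite-mirror i = begin
    toℕ (opposite i) + suc (toℕ i)    ≡⟨ cong (_+ suc (toℕ i)) (opposite-prop i) ⟩
    2 * m ∸ suc (toℕ i) + suc (toℕ i) ≡⟨ m∸n+n≡m (toℕ<n i) ⟩
    2 * m                             ≡⟨ 2m≡m+m ⟩
    m + m                             ∎
    where open ≡-Reasoning

  arc : Fin (2 * m) → Zone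
  arc i = zone m (toℕ i)

  arc-opposite : ∀ i → arc (opposite i) ≡ flip (arc i)
  arc-opposite i = zone-mirror {m} (opposite-mirror i)

  arc-antipode-opposite : ∀ i → arc (antipode (opposite i)) ≡ flip (arc (antipode i))
  arc-antipode-opposite i = zone-mirror {m} (Antipodal-mirror (toℕ<m+m _) (toℕ<m+m _)
    (antipode-antipodal i) (antipode-antipodal (opposite i)) (opposite-mirror i))

  arc-separated : ∀ {i j} → cycAdj (2 * m) i j → arc i ≢ arc (antipode j)
  arc-separated {i} {j} i~j arcs≡ = NearAntipodal-separated 3≤m (toℕ<m+m i) (toℕ<m+m (antipode j))
    (zone-spec m (toℕ i)) (subst (λ z → InZone z m _) (sym arcs≡) (zone-spec m _))
    (NearMod-Antipodal⇒NearAntipodal (≤-trans (s≤s z≤n) 3≤m) (toℕ<m+m i) (toℕ<m+m (antipode j))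
      (cycAdj⇒NearMod i~j) (antipode-antipodal j))

  recolour : ∀ {n} → Fin (suc (suc n)) → Fin (2 * m) → Fin (suc (suc (n + 1)))
  recolour zero          i = paint (arc i)
  recolour (suc zero)    i = paint (arc (antipode i))
  recolour (suc (suc c)) i = old c

  recolour-antipode : ∀ {n} (c : Fin (suc (suc n))) i → recolour (swap12 c) (antipode i) ≡ recolour c i
  recolour-antipode zero          i = cong (paint ∘ arc) (antipode-involutive i)
  recolour-antipode (suc zero)    i = refl
  recolour-antipode (suc (suc c)) i = refl

  recolour-opposite : ∀ {n} (c : Fin (suc (suc n))) i → recolour c (opposite i) ≡ swap12 (recolour c i)
  recolour-opposite zero          i = trans (cong paint (arc-opposite i)) (paint-flip (arc i))
  recolour-opposite (suc zero)    i = trans (cong paint (arc-antipode-opposite i)) (paint-flip (arc (antipode i)))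
  recolour-opposite (suc (suc c)) i = refl

  recolour-proper : ∀ {n} {c c' : Fin (suc (suc n))} {i j} → c ≢ c' → cycAdj (2 * m) i j →
    recolour c i ≢ recolour c' j
  recolour-proper {c = zero}          {zero}           c≢c' _ = ⊥-elim (c≢c' refl)
  recolour-proper {c = suc zero}      {suc zero}       c≢c' _ = ⊥-elim (c≢c' refl)
  recolour-proper {c = zero}          {suc zero}       _ i~j  = arc-separated i~j ∘ paint-injective
  recolour-proper {c = suc zero}      {zero}           _ i~j  = arc-separated (cycAdj-sym i~j) ∘ sym ∘ paint-injective
  recolour-proper {c = zero}          {suc (suc c')}   _ _    = paint≢old _ c'
  recolour-proper {c = suc zero}      {suc (suc c')}   _ _    = paint≢old _ c'
  recolour-proper {c = suc (suc c)}   {zero}           _ _    = paint≢old _ c ∘ sym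
  recolour-proper {c = suc (suc c)}   {suc zero}       _ _    = paint≢old _ c ∘ sym
  recolour-proper {c = suc (suc c)}   {suc (suc c')}   c≢c' _ = c≢c' ∘ cong (λ x → suc (suc x)) ∘ old-injective

lemma3p10 : (T : Z2Graph) (n m : ℕ) → 3 ≤ m →
    EquivHomToK T n → EquivHomQuotToK T m (n + 1)
lemma3p10 T n m 3≤m (f , f-proper , f-equivariant) = g , g-respects , g-proper , g-equivariant
  where
  open Z2Graph T
  open Cycle m 3≤m

  g : PV T m → Fin (suc (suc (n + 1)))
  g (t , i) = recolour (f t) i

  g-respects : ∀ x y → PEquiv T m x y → g x ≡ g y
  g-respects _       _ (inj₁ (refl , refl)) = refl
  g-respects (t , i) _ (inj₂ (refl , refl)) =
    sym (trans (cong (λ c → recolour c (antipode i)) (f-equivariant t)) (recolour-antipode (f t) i))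

  g-proper : ∀ x y → QAdj T m x y → g x ≢ g y
  g-proper x y ((t , i) , (t' , j) , x≈ , y≈ , t~t' , i~j) gx≡gy =
    recolour-proper (f-proper t~t') i~j (trans (sym (g-respects x _ x≈)) (trans gx≡gy (g-respects y _ y≈)))

  g-equivariant : ∀ t i → g (t , opposite i) ≡ swap12 (g (t , i))
  g-equivariant t = recolour-opposite (f t)
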